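{- Let $G=([n],E)$ be a natural unit interval graph. If $i\ge n+j$, or if $j\ge i\ge n\ge2$, then $\mathrm{SYT}^{(i)}(G+K_j)$ is empty, so $(T_G(q))_{i,j}=0$.
   Context: For $G$ on $[n]$, $G+K_j$ is the graph on $[n+j-1]$ obtained by gluing vertex $n$ of $G$ to vertex $1$ of the complete graph $K_j$: edges $E(G)\cup\{\{a+n-1,b+n-1\}:1\le a<b\le j\}$. NUIG: graph on $[n]$ with $i<j<k$, $\{i,k\}\in E$ implying $\{i,j\},\{j,k\}\in E$. $[k]_q=1+\dots+q^{k-1}$, $[k]_q!=[1]_q\cdots[k]_q$; $e_\lambda$ elementary symmetric functions. Tableaux (for a graph $G$ on $[n]$): rows of Young diagrams are numbered from the bottom, columns from the left. For $T\in\mathrm{SYT}_n$, $b_k(T)$ is the column containing $k$. $\bar G$ has edges $\{n+1-j,n+1-i\}$ for $\{i,j\}\in E(G)$. For $1\le k\le n$, $T|_{<k}$ is the restriction to entries $<k$, $\mathrm{cols}_k$ its number of columns, $\delta^{(k)}=(\delta_0,\dots,\delta_{\mathrm{cols}_k+1})$ with $\delta_0=1$, $\delta_{\mathrm{cols}_k+1}=0$, and $\delta_i=1$ ($1\le i\le\mathrm{cols}_k$) iff the top entry of column $i$ of $T|_{<k}$ is a $\bar G$-neighbour of $k$. $R_k(T)=\{1\le i\le\mathrm{cols}_k:\delta_i=1,\delta_{i-1}=0\}$, $W_k(T)=\{1\le i\le\mathrm{cols}_k+1:\delta_i=0,\delta_{i-1}=1\}$. $\mathrm{SYT}(G)=\{T\in\mathrm{SYT}_n: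 b_k(T)\in W_k(T)\ \forall k\}$. $c_T(G)=\prod_{k=1}^n q^{|\{1\le j\le\mathrm{cols}_k: j>b_k,\delta_j=1\}|}[b_k]_q\frac{\prod_{i\in R_k(T)}[|i-b_k|]_q}{\prod_{i\in W_k(T),i\neq b_k}[|i-b_k|]_q}$ with $b_k=b_k(T)$. $\mathrm{shape}'(T)$ is the shape with one instance of $b_n(T)$ removed. $\mathrm{SYT}^{(i)}(G+K_j)=\{T\in\mathrm{SYT}(G+K_j):\text{entry }n+j-1\text{ in column }i\}$ and $(T_G(q))_{i,j}=\frac1{[i]_q[j-1]_q!}\sum_{T\in\mathrm{SYT}^{(i)}(G+K_j)}c_T(G+K_j)e_{\mathrm{shape}'(T)}$. -}

module Defs where

open import Data.Nat using (ℕ; zero; suc; _+_; _∸_; _≤_; _<_; _⊔_; _≡ᵇ_; _≤ᵇ_; _<ᵇ_; pred)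
open import Data.Bool using (Bool; true; false; _∧_; _∨_; not; if_then_else_)
open import Data.Maybe using (Maybe; just; nothing)
open import Data.Product using (Σ; _×_; _,_)
open import Relation.Binary.PropositionalEquality using (_≡_)

record Graph (n : ℕ) : Set where
  field
    adj     : ℕ → ℕ → Bool
    sym     : ∀ a b → adj a b ≡ adj b a
    irrefl  : ∀ a → adj a a ≡ false
    support : ∀ a b → adj a b ≡ true → (1 ≤ a × a ≤ n) × (1 ≤ b × b ≤ n)

open Graph public

IsNUIG : {n : ℕ} → Graph n → Set
IsNUIG {n} G = ∀ i j k → i < j → j < k → k ≤ n →
  adj G i k ≡ true → (adj G i j ≡ true) × (adj G j k ≡ true)

-- Adjacency of G + K_j on [n+j-1]: edges of G together with all pairs
-- of distinct vertices of {n, …, n+j-1} (the shifted copy of K_j whose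
-- vertex 1 is glued to vertex n of G).
plusKAdj : {n : ℕ} → Graph n → ℕ → ℕ → ℕ → Bool
plusKAdj {n} G j a b =
  adj G a b ∨
  ((n ≤ᵇ a) ∧ (a ≤ᵇ (n + j ∸ 1)) ∧ (n ≤ᵇ b) ∧ (b ≤ᵇ (n + j ∸ 1)) ∧ not (a ≡ᵇ b))

barAdj : ℕ → (ℕ → ℕ → Bool) → ℕ → ℕ → Bool
barAdj N A a b = A (suc N ∸ a) (suc N ∸ b)

-- Entry k sits in the cell
-- (row k, col k); rows are numbered from the bottom, columns from the
-- left, both starting at 1.  The cells form a (French) Young diagram and
-- entries increase along rows and up columns: every occupied cell not in
-- the bottom row (resp. first column) has the cell directly below (resp.
-- to its left) occupied by a smaller entry.

InRange : ℕ → ℕ → Set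
InRange N k = 1 ≤ k × k ≤ N

record SYT (N : ℕ) : Set where
  field
    row : ℕ → ℕ
    col : ℕ → ℕ
    pos   : ∀ k → InRange N k → 1 ≤ row k × 1 ≤ col k
    inj   : ∀ k m → InRange N k → InRange N m →
            row k ≡ row m → col k ≡ col m → k ≡ m
    below : ∀ k → InRange N k → 2 ≤ row k →
            Σ ℕ λ m → (1 ≤ m × m < k) × (row m ≡ pred (row k) × col m ≡ col k)
    left  : ∀ k → InRange N k → 2 ≤ col k →
            Σ ℕ λ m → (1 ≤ m × m < k) × (row m ≡ row k × col m ≡ pred (col k))

open SYT public

b : {N : ℕ} → SYT N → ℕ → ℕ
b T k = col T k

colsLt : (ℕ → ℕ) → ℕ → ℕ
colsLt c zero = 0
colsLt c (suc zero) = 0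
colsLt c (suc (suc m)) = colsLt c (suc m) ⊔ c (suc m)

-- Top entry of column i of T|_{<k}: the largest m with 1 ≤ m < k in
-- column i (the top one, as columns increase upwards).
topLt : (ℕ → ℕ) → ℕ → ℕ → Maybe ℕ
topLt c i zero = nothing
topLt c i (suc zero) = nothing
topLt c i (suc (suc m)) =
  if c (suc m) ≡ᵇ i then just (suc m) else topLt c i (suc m)

δ : {N : ℕ} → (ℕ → ℕ → Bool) → SYT N → ℕ → ℕ → Bool
δ {N} A T k zero = true
δ {N} A T k (suc i) with suc i ≤ᵇ colsLt (col T) k | topLt (col T) (suc i) k
... | true  | just m  = barAdj N A m k
... | true  | nothing = false
... | false | _       = false

InW : {N : ℕ} → (ℕ → ℕ → Bool) → SYT N → ℕ → ℕ → Set
InW A T k i =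
  (1 ≤ i × i ≤ suc (colsLt (col T) k)) ×
  (δ A T k i ≡ false × δ A T k (pred i) ≡ true)

InSYTG : {N : ℕ} → (ℕ → ℕ → Bool) → SYT N → Set
InSYTG {N} A T = ∀ k → InRange N k → InW A T k (b T k)

SYTi : {n : ℕ} → Graph n → ℕ → ℕ → Set
SYTi {n} G j i =
  Σ (SYT (n + j ∸ 1)) λ T → InSYTG (plusKAdj G j) T × col T (n + j ∸ 1) ≡ i

{-# OPTIONS --safe #-}
-- The reversal of G + K_j has the clique {1,…,j} as an initial segment, so in a tableau of
-- SYT(G + K_j) the δ-vector of each k ≤ j is 1 on all earlier columns and the only admissible
-- column for k is k: the entries 1,…,j fill the first j cells of the bottom row.  The last entry
-- N = n + j − 1 lies in a column ≤ N, which excludes i ≥ n + j.  If n ≤ i ≤ j, N is not in the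
-- bottom row (that cell holds i ≤ j < N as n ≥ 2), so the i cells of its row up to it carry
-- increasing entries > j, whence N ≥ j + i ≥ j + n > N.
module Submission where

open import Defs
open import Data.Nat using (ℕ; zero; suc; _+_; _∸_; _≤_; _<_; _⊔_; _≤ᵇ_; _≡ᵇ_; pred; z≤n; s≤s; s≤s⁻¹)
open import Data.Nat.Properties
open import Data.Bool using (Bool; true; false)
open import Data.Bool.Properties using (∨-zeroʳ)
open import Data.Maybe using (just)
open import Data.Product using (_×_; _,_; proj₁; proj₂)
open import Data.Sum using (_⊎_; inj₁; inj₂)
open import Relation.Nullary using (¬_; contradiction)
open import Relation.Nullary.Decidable using (dec-true; dec-false)
open import Relation.Binary.PropositionalEquality as ≡ using (_≡_; _≢_; refl; trans; cong; cong₂; subst)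

≤ᵇ-true : ∀ {m n} → m ≤ n → (m ≤ᵇ n) ≡ true
≤ᵇ-true {m} {n} = dec-true (m ≤? n)

≡ᵇ-true : ∀ {m n} → m ≡ n → (m ≡ᵇ n) ≡ true
≡ᵇ-true {m} {n} = dec-true (m ≟ n)

≡ᵇ-false : ∀ {m n} → m ≢ n → (m ≡ᵇ n) ≡ false
≡ᵇ-false {m} {n} = dec-false (m ≟ n)

IsCliqueOn : (ℕ → ℕ → Bool) → ℕ → Set
IsCliqueOn A L = ∀ {a b} → 1 ≤ a → a ≤ L → 1 ≤ b → b ≤ L → a ≢ b → A a b ≡ true

IsDiagonalOn : (ℕ → ℕ) → ℕ → Set
IsDiagonalOn c M = ∀ {m} → 1 ≤ m → m ≤ M → c m ≡ m

module _ (c : ℕ → ℕ) where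

  colsLt-diagonal : ∀ M → IsDiagonalOn c M → colsLt c (suc M) ≡ M
  colsLt-diagonal zero _ = refl
  colsLt-diagonal (suc M) c≡id = begin
    colsLt c (suc M) ⊔ c (suc M)
      ≡⟨ cong₂ _⊔_ (colsLt-diagonal M (λ 1≤m m≤M → c≡id 1≤m (m≤n⇒m≤1+n m≤M)))
                   (c≡id (s≤s z≤n) ≤-refl) ⟩
    M ⊔ suc M
      ≡⟨ m≤n⇒m⊔n≡n (n≤1+n M) ⟩
    suc M ∎
    where open ≡.≡-Reasoning

  topLt-diagonal : ∀ M {i} → IsDiagonalOn c M → 1 ≤ i → i ≤ M → topLt c i (suc M) ≡ just i
  topLt-diagonal zero _ (s≤s _) ()
  topLt-diagonal (suc M) {i} c≡id 1≤i i≤1+M with m≤n⇒m<n∨m≡n i≤1+M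
  ... | inj₂ refl rewrite ≡ᵇ-true (c≡id 1≤i ≤-refl) = refl
  ... | inj₁ i<1+M rewrite ≡ᵇ-false (λ c[1+M]≡i → <⇒≢ i<1+M (trans (≡.sym c[1+M]≡i) (c≡id (s≤s z≤n) ≤-refl)))
    = topLt-diagonal M (λ 1≤m m≤M → c≡id 1≤m (m≤n⇒m≤1+n m≤M)) 1≤i (s≤s⁻¹ i<1+M)

module _ {N : ℕ} (T : SYT N) where

  col≤entry : ∀ c {m} → InRange N m → col T m ≡ c → c ≤ m
  col≤entry zero _ _ = z≤n
  col≤entry (suc zero) (1≤m , _) _ = 1≤m
  col≤entry (suc (suc c)) {m} (1≤m , m≤N) col≡ =
    let m′ , (1≤m′ , m′<m) , _ , col≡′ = left T m (1≤m , m≤N) (subst (2 ≤_) (≡.sym col≡) (s≤s (s≤s z≤n)))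
    in ≤-trans (s≤s (col≤entry (suc c) (1≤m′ , ≤-trans (<⇒≤ m′<m) m≤N) (trans col≡′ (cong pred col≡)))) m′<m

  δ-diagonal : ∀ (A : ℕ → ℕ → Bool) {M i} → IsDiagonalOn (col T) M → 1 ≤ i → i ≤ M →
               δ A T (suc M) i ≡ barAdj N A i (suc M)
  δ-diagonal A {M} {suc i} c≡id _ i≤M
    rewrite colsLt-diagonal (col T) M c≡id | ≤ᵇ-true i≤M | topLt-diagonal (col T) M c≡id (s≤s z≤n) i≤M
    = refl

  diagonal⇒row≡1 : ∀ {L} → L ≤ N → IsDiagonalOn (col T) L → ∀ {m} → 1 ≤ m → m ≤ L → row T m ≡ 1
  diagonal⇒row≡1 L≤N c≡id {m} 1≤m m≤L = ≤-antisym (≮⇒≥ not-above-bottom) (proj₁ (pos T m m∈N))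
    where
    m∈N = 1≤m , ≤-trans m≤L L≤N
    not-above-bottom : ¬ 1 < row T m
    not-above-bottom 1<row =
      let m′ , (1≤m′ , m′<m) , _ , col≡ = below T m m∈N 1<row
      in <⇒≢ m′<m (begin
        m′       ≡⟨ ≡.sym (c≡id 1≤m′ (≤-trans (<⇒≤ m′<m) m≤L)) ⟩
        col T m′ ≡⟨ col≡ ⟩
        col T m  ≡⟨ c≡id 1≤m m≤L ⟩
        m        ∎)
      where open ≡.≡-Reasoning

  bottom-prefix⇒L<entry : ∀ {L} → (∀ {m} → 1 ≤ m → m ≤ L → row T m ≡ 1) →
                          ∀ {m} → InRange N m → 1 < row T m → L < m
  bottom-prefix⇒L<entry bottom (1≤m , _) 1<row = ≰⇒> λ m≤L → <-irrefl (≡.sym (bottom 1≤m m≤L)) 1<row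

  bottom-prefix⇒L+col≤entry : ∀ {L} → (∀ {m} → 1 ≤ m → m ≤ L → row T m ≡ 1) →
                              ∀ c {m} → InRange N m → 1 < row T m → col T m ≡ c → L + c ≤ m
  bottom-prefix⇒L+col≤entry {L} bottom zero {m} m∈N 1<row _ =
    subst (_≤ m) (≡.sym (+-identityʳ L)) (<⇒≤ (bottom-prefix⇒L<entry bottom m∈N 1<row))
  bottom-prefix⇒L+col≤entry {L} bottom (suc zero) {m} m∈N 1<row _ =
    subst (_≤ m) (+-comm 1 L) (bottom-prefix⇒L<entry bottom m∈N 1<row)
  bottom-prefix⇒L+col≤entry {L} bottom (suc (suc c)) {m} (1≤m , m≤N) 1<row col≡ =
    let m′ , (1≤m′ , m′<m) , row≡ , col≡′ = left T m (1≤m , m≤N) (subst (2 ≤_) (≡.sym col≡) (s≤s (s≤s z≤n)))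
        L+c≤m′ = bottom-prefix⇒L+col≤entry bottom (suc c) (1≤m′ , ≤-trans (<⇒≤ m′<m) m≤N)
                   (subst (1 <_) (≡.sym row≡) 1<row) (trans col≡′ (cong pred col≡))
    in subst (_≤ m) (≡.sym (+-suc L (suc c))) (≤-trans (s≤s L+c≤m′) m′<m)

module _ {N : ℕ} {A : ℕ → ℕ → Bool} {T : SYT N} (T∈SYT : InSYTG A T) where

  -- δ^{(M+1)} is 1 on the columns 1,…,M, so W_{M+1}(T) = {M + 1}.
  col-next-diagonal : ∀ {M} → suc M ≤ N → (∀ {i} → 1 ≤ i → i ≤ M → barAdj N A i (suc M) ≡ true) →
                      IsDiagonalOn (col T) M → col T (suc M) ≡ suc M
  col-next-diagonal {M} 1+M≤N adjacent c≡id = ≤-antisym b≤1+M (≮⇒≥ b≮1+M)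
    where
    b∈W = T∈SYT (suc M) (s≤s z≤n , 1+M≤N)
    b≤1+M : col T (suc M) ≤ suc M
    b≤1+M = subst (λ cols → col T (suc M) ≤ suc cols) (colsLt-diagonal (col T) M c≡id) (proj₂ (proj₁ b∈W))
    b≮1+M : ¬ col T (suc M) < suc M
    b≮1+M b<1+M = contradiction (trans (≡.sym (proj₁ (proj₂ b∈W))) δ≡true) λ ()
      where
      1≤b = proj₁ (proj₁ b∈W)
      δ≡true = trans (δ-diagonal T A c≡id 1≤b (s≤s⁻¹ b<1+M)) (adjacent 1≤b (s≤s⁻¹ b<1+M))

  clique⇒diagonal : ∀ {L} → L ≤ N → IsCliqueOn (barAdj N A) L → IsDiagonalOn (col T) L
  clique⇒diagonal {L} L≤N clique = diagonal-upto L ≤-refl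
    where
    diagonal-upto : ∀ M → M ≤ L → IsDiagonalOn (col T) M
    diagonal-upto zero _ (s≤s _) ()
    diagonal-upto (suc M) 1+M≤L 1≤m m≤1+M with m≤n⇒m<n∨m≡n m≤1+M
    ... | inj₁ m<1+M = diagonal-upto M (<⇒≤ 1+M≤L) 1≤m (s≤s⁻¹ m<1+M)
    ... | inj₂ refl = col-next-diagonal (≤-trans 1+M≤L L≤N)
      (λ 1≤i i≤M → clique 1≤i (≤-trans i≤M (<⇒≤ 1+M≤L)) (s≤s z≤n) 1+M≤L (<⇒≢ (s≤s i≤M)))
      (diagonal-upto M (<⇒≤ 1+M≤L))

plusKAdj-clique : ∀ {n} (G : Graph n) j {a b} → n ≤ a → a ≤ n + j ∸ 1 → n ≤ b → b ≤ n + j ∸ 1 →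
                  a ≢ b → plusKAdj G j a b ≡ true
plusKAdj-clique G j {a} {b} n≤a a≤ n≤b b≤ a≢b
  rewrite ≤ᵇ-true n≤a | ≤ᵇ-true a≤ | ≤ᵇ-true n≤b | ≤ᵇ-true b≤ | ≡ᵇ-false a≢b = ∨-zeroʳ (adj G a b)

reversed-plusKAdj-clique : ∀ {n} (G : Graph (suc n)) j → IsCliqueOn (barAdj (n + j) (plusKAdj G j)) j
reversed-plusKAdj-clique {n} G j {suc a} {suc b} _ a<j _ b<j 1+a≢1+b =
  plusKAdj-clique G j (reflected-≥ a<j) (m∸n≤m (n + j) a) (reflected-≥ b<j) (m∸n≤m (n + j) b)
    λ reflected≡ → 1+a≢1+b (cong suc (∸-cancelˡ-≡ (≤-trans (<⇒≤ a<j) (m≤n+m j n)) (≤-trans (<⇒≤ b<j) (m≤n+m j n)) reflected≡))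
  where
  reflected-≥ : ∀ {c} → c < j → suc n ≤ n + j ∸ c
  reflected-≥ c<j = m+n≤o⇒m≤o∸n (suc n) (+-monoʳ-< n c<j)

last-entry∈range : ∀ n j → InRange (n + suc j) (n + suc j)
last-entry∈range n j = ≤-trans (s≤s z≤n) (m≤n+m (suc j) n) , ≤-refl

module _ {n} (G : Graph (suc n)) (j : ℕ) {T : SYT (n + suc j)} (T∈SYT : InSYTG (plusKAdj G (suc j)) T) where

  private
    J≤N : suc j ≤ n + suc j
    J≤N = m≤n+m (suc j) n

  plusKAdj-prefix-diagonal : IsDiagonalOn (col T) (suc j)
  plusKAdj-prefix-diagonal = clique⇒diagonal T∈SYT J≤N (reversed-plusKAdj-clique G (suc j))

  plusKAdj-prefix-row≡1 : ∀ {m} → 1 ≤ m → m ≤ suc j → row T m ≡ 1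
  plusKAdj-prefix-row≡1 = diagonal⇒row≡1 T J≤N plusKAdj-prefix-diagonal

  last-entry-above-bottom-row : 1 ≤ n → ∀ {i} → 1 ≤ i → i ≤ suc j → col T (n + suc j) ≡ i →
                                1 < row T (n + suc j)
  last-entry-above-bottom-row 1≤n {i} 1≤i i≤J col≡i = ≰⇒> λ row≤1 → n≮n (suc j) (begin-strict
      suc j      <⟨ +-monoˡ-≤ (suc j) 1≤n ⟩
      n + suc j  ≡⟨ inj T _ i (last-entry∈range n j) (1≤i , ≤-trans i≤J J≤N) (same-row row≤1) same-col ⟩
      i          ≤⟨ i≤J ⟩
      suc j      ∎)
    where
    open ≤-Reasoning
    same-row : row T (n + suc j) ≤ 1 → row T (n + suc j) ≡ row T i
    same-row row≤1 = trans (≤-antisym row≤1 (proj₁ (pos T _ (last-entry∈range n j))))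
                           (≡.sym (plusKAdj-prefix-row≡1 1≤i i≤J))
    same-col : col T (n + suc j) ≡ col T i
    same-col = trans col≡i (≡.sym (plusKAdj-prefix-diagonal 1≤i i≤J))

proposition4p5 : (n j i : ℕ) (G : Graph n) → IsNUIG G → 1 ≤ n → 1 ≤ j →
    (n + j ≤ i ⊎ (i ≤ j × n ≤ i × 2 ≤ n)) →
    ¬ SYTi G j i
proposition4p5 zero _ _ _ _ () _ _
proposition4p5 (suc n) zero _ _ _ _ () _
proposition4p5 (suc n) (suc j) i G _ _ _ (inj₁ n+j≤i) (T , _ , col≡i) =
  n≮n (n + suc j) (≤-trans n+j≤i (col≤entry T i (last-entry∈range n j) col≡i))
proposition4p5 (suc n) (suc j) i G _ _ _ (inj₂ (i≤j , n<i , 2≤n)) (T , T∈SYT , col≡i) =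
  n≮n (n + suc j) (begin-strict
    n + suc j  ≡⟨ +-comm n (suc j) ⟩
    suc j + n  <⟨ +-monoʳ-< (suc j) n<i ⟩
    suc j + i  ≤⟨ bottom-prefix⇒L+col≤entry T (plusKAdj-prefix-row≡1 G j T∈SYT) i (last-entry∈range n j)
                    (last-entry-above-bottom-row G j T∈SYT (s≤s⁻¹ 2≤n) 1≤i i≤j col≡i) col≡i ⟩
    n + suc j  ∎)
  where
  open ≤-Reasoning
  1≤i : 1 ≤ i
  1≤i = ≤-trans (s≤s z≤n) n<i
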